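{- For integers $n\ge 0$ and $p\ge 0$ with $n+1\ge p$, $$\sum_{j,k}\binom{n}{k}\genfrac{\{}{\}}{0pt}{}{k}{j}\genfrac{[}{]}{0pt}{}{j+1}{p}(-1)^j=\begin{cases}0, & n+1>p,\\ (-1)^n, & n+1=p.\end{cases}$$
   Context: Here $\genfrac{[}{]}{0pt}{}{n}{k}$ denotes the unsigned (absolute) Stirling number of the first kind and $\genfrac{\{}{\}}{0pt}{}{n}{k}$ the ordinary Stirling number of the second kind (Knuth's notation), with $\genfrac{[}{]}{0pt}{}{0}{0}=\genfrac{\{}{\}}{0pt}{}{0}{0}=1$, $\genfrac{[}{]}{0pt}{}{n}{0}=\genfrac{\{}{\}}{0pt}{}{n}{0}=0$ for $n>0$, and both vanish for $0\le n<k$. The double summation is over all integers $j,k$ with $0\le j\le k\le n$. -}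

module Defs where

open import Data.Nat using (ℕ; zero; suc; _+_; _*_)
open import Data.Integer using (ℤ; +_; -_)
import Data.Integer as ℤ

stirling1 : ℕ → ℕ → ℕ
stirling1 zero    zero    = 1
stirling1 zero    (suc k) = 0
stirling1 (suc n) zero    = 0
stirling1 (suc n) (suc k) = n * stirling1 n (suc k) + stirling1 n k

stirling2 : ℕ → ℕ → ℕ
stirling2 zero    zero    = 1
stirling2 zero    (suc k) = 0
stirling2 (suc n) zero    = 0
stirling2 (suc n) (suc k) = suc k * stirling2 n (suc k) + stirling2 n k

sign : ℕ → ℤ
sign zero    = + 1
sign (suc j) = - sign j

-- Σ_{i=0}^{n} f i  (inclusive upper bound)
sumTo : ℕ → (ℕ → ℤ) → ℤ
sumTo zero    f = f 0
sumTo (suc n) f = sumTo n f ℤ.+ f (suc n)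

module Submission where

-- Both inner and outer sums are "alternating transforms"
--   c ↦ Σ_j w(k,j) (-1)^j c(j)
-- along a triangular array w obeying a Pascal-type recurrence
--   w(k+1,j+1) = a(j+1) w(k,j+1) + w(k,j),  w(k+1,0) = a(0) w(k,0),  w(k,k+1) = 0;
-- binomial coefficients (a ≡ 1) and Stirling numbers of the second kind
-- (a(j) = j) are both of this shape.  For such arrays one step in k turns the
-- transform of c into the transform of j ↦ a(j) c(j) - c(j+1) (module
-- PascalRecurrence).  Applied to the Stirling array with c(j) = [j+1 p] and
-- the recurrence of [· ·], this gives Σ_j {k j} (-1)^j [j+1 q+1] = (-1)^k C(k,q)
-- and 0 for p = 0.  Applied to the binomial array with c(k) = C(k,q) it gives
-- Σ_k C(n,k) (-1)^k C(k,q) = 0 for q < n and (-1)^n for q = n, which is the theorem.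

open import Defs
open import Data.Nat using (ℕ; suc; _+_; _≤_; _<_)
open import Data.Nat.Combinatorics using (_C_)
open import Data.Integer using (ℤ; +_; _*_)
open import Relation.Binary.PropositionalEquality using (_≡_)
open import Data.Product using (_×_)

open import Data.Nat using (zero; s≤s)
import Data.Nat as ℕ
import Data.Nat.Properties as ℕ
open import Data.Nat.Combinatorics using (nCk+nC[k+1]≡[n+1]C[k+1])
open import Data.Nat.Combinatorics.Specification using (k>n⇒nCk≡0)
open import Data.Integer using (-_; _-_) renaming (_+_ to _⊕_)
open import Data.Integer.Properties using (pos-+; pos-*; +-assoc; +-identityʳ; *-zeroʳ)
open import Data.Integer.Tactic.RingSolver using (solve-∀)
open import Relation.Binary.PropositionalEquality using (refl; sym; trans; cong; cong₂; module ≡-Reasoning)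
open import Data.Product using (_,_)
open ≡-Reasoning

sum-cong : ∀ n {f g : ℕ → ℤ} → (∀ i → f i ≡ g i) → sumTo n f ≡ sumTo n g
sum-cong zero    e = e 0
sum-cong (suc n) e = cong₂ _⊕_ (sum-cong n e) (e (suc n))

sum-zero : ∀ n (f : ℕ → ℤ) → (∀ i → f i ≡ + 0) → sumTo n f ≡ + 0
sum-zero zero    f e = e 0
sum-zero (suc n) f e = cong₂ _⊕_ (sum-zero n f e) (e (suc n))

sum-+ : ∀ n (f g : ℕ → ℤ) → sumTo n (λ i → f i ⊕ g i) ≡ sumTo n f ⊕ sumTo n g
sum-+ zero    f g = refl
sum-+ (suc n) f g = trans (cong (_⊕ (f (suc n) ⊕ g (suc n))) (sum-+ n f g))
                          (interchange (sumTo n f) (sumTo n g) (f (suc n)) (g (suc n)))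
  where
  interchange : ∀ a b c d → (a ⊕ b) ⊕ (c ⊕ d) ≡ (a ⊕ c) ⊕ (b ⊕ d)
  interchange = solve-∀

sum-neg : ∀ n (f : ℕ → ℤ) → sumTo n (λ i → - f i) ≡ - sumTo n f
sum-neg zero    f = refl
sum-neg (suc n) f = trans (cong (_⊕ (- f (suc n))) (sum-neg n f)) (neg-+ (sumTo n f) (f (suc n)))
  where
  neg-+ : ∀ a b → - a ⊕ - b ≡ - (a ⊕ b)
  neg-+ = solve-∀

sum-scale : ∀ n (c : ℤ) (f : ℕ → ℤ) → sumTo n (λ i → c * f i) ≡ c * sumTo n f
sum-scale zero    c f = refl
sum-scale (suc n) c f = trans (cong (_⊕ (c * f (suc n))) (sum-scale n c f)) (distrib c (sumTo n f) (f (suc n)))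
  where
  distrib : ∀ c a b → c * a ⊕ c * b ≡ c * (a ⊕ b)
  distrib = solve-∀

sum-peel : ∀ n (f : ℕ → ℤ) → sumTo (suc n) f ≡ f 0 ⊕ sumTo n (λ i → f (suc i))
sum-peel zero    f = refl
sum-peel (suc n) f = trans (cong (_⊕ f (suc (suc n))) (sum-peel n f))
                           (+-assoc (f 0) (sumTo n (λ i → f (suc i))) (f (suc (suc n))))

sum-drop-last : ∀ n (f : ℕ → ℤ) → f (suc n) ≡ + 0 → sumTo (suc n) f ≡ sumTo n f
sum-drop-last n f e = trans (cong (sumTo n f ⊕_) e) (+-identityʳ (sumTo n f))

module PascalRecurrence
  (w : ℕ → ℕ → ℤ) (a : ℕ → ℤ)
  (w-zero  : ∀ k → w (suc k) 0 ≡ a 0 * w k 0)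
  (w-suc   : ∀ k j → w (suc k) (suc j) ≡ a (suc j) * w k (suc j) ⊕ w k j)
  (w-above : ∀ k → w k (suc k) ≡ + 0)
  where

  transform : ℕ → (ℕ → ℤ) → ℤ
  transform k c = sumTo k (λ j → w k j * (sign j * c j))

  transform-cong : ∀ k {c d : ℕ → ℤ} → (∀ j → c j ≡ d j) → transform k c ≡ transform k d
  transform-cong k e = sum-cong k (λ j → cong (λ x → w k j * (sign j * x)) (e j))

  transform-zero : ∀ k → transform k (λ _ → + 0) ≡ + 0
  transform-zero k = sum-zero k _ (λ j → trans (cong (w k j *_) (*-zeroʳ (sign j))) (*-zeroʳ (w k j)))

  transform-neg-+ : ∀ k (c d : ℕ → ℤ) →
    transform k (λ j → - (c j ⊕ d j)) ≡ - (transform k c ⊕ transform k d)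
  transform-neg-+ k c d = begin
    transform k (λ j → - (c j ⊕ d j))
      ≡⟨ sum-cong k (λ j → split (w k j) (sign j) (c j) (d j)) ⟩
    sumTo k (λ j → - (w k j * (sign j * c j)) ⊕ - (w k j * (sign j * d j)))
      ≡⟨ sum-+ k _ _ ⟩
    sumTo k (λ j → - (w k j * (sign j * c j))) ⊕ sumTo k (λ j → - (w k j * (sign j * d j)))
      ≡⟨ cong₂ _⊕_ (sum-neg k _) (sum-neg k _) ⟩
    - transform k c ⊕ - transform k d
      ≡⟨ neg-+ (transform k c) (transform k d) ⟩
    - (transform k c ⊕ transform k d) ∎
    where
    split : ∀ x s u v → x * (s * - (u ⊕ v)) ≡ - (x * (s * u)) ⊕ - (x * (s * v))
    split = solve-∀
    neg-+ : ∀ u v → - u ⊕ - v ≡ - (u ⊕ v)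
    neg-+ = solve-∀

  transform-neg : ∀ k (c : ℕ → ℤ) → transform k (λ j → - c j) ≡ - transform k c
  transform-neg k c = trans (sum-cong k (λ j → pull-neg (w k j) (sign j) (c j))) (sum-neg k _)
    where
    pull-neg : ∀ x s u → x * (s * - u) ≡ - (x * (s * u))
    pull-neg = solve-∀

  -- Splitting w(k+1,j+1) by the recurrence, the a-part re-indexes to the first
  -- sum (its extra term vanishes since w(k,k+1) = 0), the other part to the second.
  transform-step : ∀ k (c : ℕ → ℤ) → transform (suc k) c ≡ transform k (λ j → a j * c j - c (suc j))
  transform-step k c = begin
    sumTo (suc k) F                            ≡⟨ sum-peel k F ⟩
    F 0 ⊕ sumTo k (λ j → F (suc j))            ≡⟨ cong₂ _⊕_ F0≡G0 (sum-cong k F-split) ⟩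
    G 0 ⊕ sumTo k (λ j → G (suc j) ⊕ H j)      ≡⟨ cong (G 0 ⊕_) (sum-+ k (λ j → G (suc j)) H) ⟩
    G 0 ⊕ (sumTo k (λ j → G (suc j)) ⊕ sumTo k H)
                                               ≡⟨ sym (+-assoc (G 0) _ (sumTo k H)) ⟩
    (G 0 ⊕ sumTo k (λ j → G (suc j))) ⊕ sumTo k H
                                               ≡⟨ cong (_⊕ sumTo k H) (sym (sum-peel k G)) ⟩
    sumTo (suc k) G ⊕ sumTo k H                ≡⟨ cong (_⊕ sumTo k H) (sum-drop-last k G G-top) ⟩
    sumTo k G ⊕ sumTo k H                      ≡⟨ sym (sum-+ k G H) ⟩
    sumTo k (λ j → G j ⊕ H j)                  ≡⟨ sum-cong k (λ j → merge (w k j) (sign j) (a j) (c j) (c (suc j))) ⟩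
    transform k (λ j → a j * c j - c (suc j))  ∎
    where
    F G H : ℕ → ℤ
    F j = w (suc k) j * (sign j * c j)
    G j = w k j * (sign j * (a j * c j))
    H j = w k j * (sign j * - c (suc j))

    F0≡G0 : F 0 ≡ G 0
    F0≡G0 = trans (cong (λ x → x * (+ 1 * c 0)) (w-zero k)) (regroup (a 0) (w k 0) (c 0))
      where
      regroup : ∀ α x u → α * x * (+ 1 * u) ≡ x * (+ 1 * (α * u))
      regroup = solve-∀

    F-split : ∀ j → F (suc j) ≡ G (suc j) ⊕ H j
    F-split j = trans (cong (λ x → x * (sign (suc j) * c (suc j))) (w-suc k j))
                      (distribute (a (suc j)) (w k (suc j)) (w k j) (sign j) (c (suc j)))
      where
      distribute : ∀ α x y s u → (α * x ⊕ y) * (- s * u) ≡ x * (- s * (α * u)) ⊕ y * (s * - u)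
      distribute = solve-∀

    G-top : G (suc k) ≡ + 0
    G-top = cong (λ x → x * (sign (suc k) * (a (suc k) * c (suc k)))) (w-above k)

    merge : ∀ x s α u v → x * (s * (α * u)) ⊕ x * (s * - v) ≡ x * (s * (α * u - v))
    merge = solve-∀

pos-affine : ∀ m x y → + (m ℕ.* x ℕ.+ y) ≡ + m * + x ⊕ + y
pos-affine m x y = trans (pos-+ (m ℕ.* x) y) (cong (_⊕ + y) (pos-* m x))

pascal : ∀ n k → + (suc n C suc k) ≡ + (n C k) ⊕ + (n C suc k)
pascal n k = trans (cong +_ (sym (nCk+nC[k+1]≡[n+1]C[k+1] n k))) (pos-+ (n C k) (n C suc k))

stirling2-above : ∀ {k m} → k < m → stirling2 k m ≡ 0
stirling2-above {zero}  {suc m} _         = refl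
stirling2-above {suc k} {suc m} (s≤s k<m) =
  cong₂ ℕ._+_ (trans (cong (suc m ℕ.*_) (stirling2-above (ℕ.m<n⇒m<1+n k<m))) (ℕ.*-zeroʳ (suc m)))
              (stirling2-above k<m)

-- Pascal's rule in the shape required by PascalRecurrence with a ≡ 1.
pascal-recurrence : ∀ n k → + (suc n C suc k) ≡ + 1 * + (n C suc k) ⊕ + (n C k)
pascal-recurrence n k = trans (pascal n k) (swap (+ (n C k)) (+ (n C suc k)))
  where
  swap : ∀ u v → u ⊕ v ≡ + 1 * v ⊕ u
  swap = solve-∀

module Binomial = PascalRecurrence (λ n k → + (n C k)) (λ _ → + 1)
  (λ n → refl)
  pascal-recurrence
  (λ n → cong +_ (k>n⇒nCk≡0 (ℕ.n<1+n n)))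

module Stirling2 = PascalRecurrence (λ k j → + stirling2 k j) +_
  (λ k → refl)
  (λ k j → pos-affine (suc j) (stirling2 k (suc j)) (stirling2 k j))
  (λ k → cong +_ (stirling2-above (ℕ.n<1+n k)))

stirling1-step : ∀ j q →
  + stirling1 (suc (suc j)) (suc q) ≡ (+ 1 ⊕ + j) * + stirling1 (suc j) (suc q) ⊕ + stirling1 (suc j) q
stirling1-step j q = trans (pos-affine (suc j) (stirling1 (suc j) (suc q)) (stirling1 (suc j) q))
                           (cong (λ x → x * + stirling1 (suc j) (suc q) ⊕ + stirling1 (suc j) q) (pos-+ 1 j))

T : ℕ → ℕ → ℤ
T k p = Stirling2.transform k (λ j → + stirling1 (suc j) p)

-- [j+1 0] = 0, so the column p = 0 vanishes.
T-zero : ∀ k → T k 0 ≡ + 0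
T-zero = Stirling2.transform-zero

-- One step of PascalRecurrence, simplified with the recurrence of [· ·]:
-- T(k+1,q+1) = -(T(k,q+1) + T(k,q)).
T-step : ∀ k q → T (suc k) (suc q) ≡ - (T k (suc q) ⊕ T k q)
T-step k q = begin
  T (suc k) (suc q)
    ≡⟨ Stirling2.transform-step k (λ j → + stirling1 (suc j) (suc q)) ⟩
  Stirling2.transform k (λ j → + j * + stirling1 (suc j) (suc q) - + stirling1 (suc (suc j)) (suc q))
    ≡⟨ Stirling2.transform-cong k simplify ⟩
  Stirling2.transform k (λ j → - (+ stirling1 (suc j) (suc q) ⊕ + stirling1 (suc j) q))
    ≡⟨ Stirling2.transform-neg-+ k _ _ ⟩
  - (T k (suc q) ⊕ T k q) ∎
  where
  cancel : ∀ J u v → J * u - ((+ 1 ⊕ J) * u ⊕ v) ≡ - (u ⊕ v)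
  cancel = solve-∀
  simplify : ∀ j → + j * + stirling1 (suc j) (suc q) - + stirling1 (suc (suc j)) (suc q)
                 ≡ - (+ stirling1 (suc j) (suc q) ⊕ + stirling1 (suc j) q)
  simplify j = trans (cong (λ x → + j * + stirling1 (suc j) (suc q) - x) (stirling1-step j q))
                     (cancel (+ j) (+ stirling1 (suc j) (suc q)) (+ stirling1 (suc j) q))

T-closed : ∀ k q → T k (suc q) ≡ sign k * + (k C q)
T-closed zero    zero    = refl
T-closed zero    (suc q) = refl
T-closed (suc k) zero    = begin
  T (suc k) 1                    ≡⟨ T-step k 0 ⟩
  - (T k 1 ⊕ T k 0)              ≡⟨ cong₂ (λ x y → - (x ⊕ y)) (T-closed k 0) (T-zero k) ⟩
  - (sign k * + 1 ⊕ + 0)         ≡⟨ tidy (sign k) ⟩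
  - sign k * + 1                 ∎
  where
  tidy : ∀ s → - (s * + 1 ⊕ + 0) ≡ - s * + 1
  tidy = solve-∀
T-closed (suc k) (suc q) = begin
  T (suc k) (suc (suc q))                          ≡⟨ T-step k (suc q) ⟩
  - (T k (suc (suc q)) ⊕ T k (suc q))              ≡⟨ cong₂ (λ x y → - (x ⊕ y)) (T-closed k (suc q)) (T-closed k q) ⟩
  - (sign k * + (k C suc q) ⊕ sign k * + (k C q))  ≡⟨ factor (sign k) (+ (k C q)) (+ (k C suc q)) ⟩
  - sign k * (+ (k C q) ⊕ + (k C suc q))           ≡⟨ cong (- sign k *_) (sym (pascal k q)) ⟩
  - sign k * + (suc k C suc q)                     ∎
  where
  factor : ∀ s u v → - (s * v ⊕ s * u) ≡ - s * (u ⊕ v)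
  factor = solve-∀

-- B(n,q) = Σ_k C(n,k) (-1)^k C(k,q), the outer sum once T is evaluated.
B : ℕ → ℕ → ℤ
B n q = Binomial.transform n (λ k → + (k C q))

-- B(n+1,0) = 0, since the transformed column 1·1 - 1 vanishes.
B-suc-zero : ∀ n → B (suc n) 0 ≡ + 0
B-suc-zero n = trans (Binomial.transform-step n _) (Binomial.transform-zero n)

-- B(n+1,q+1) = -B(n,q), since 1·C(k,q+1) - C(k+1,q+1) = -C(k,q) by Pascal's rule.
B-suc-suc : ∀ n q → B (suc n) (suc q) ≡ - B n q
B-suc-suc n q = begin
  B (suc n) (suc q)                                                  ≡⟨ Binomial.transform-step n _ ⟩
  Binomial.transform n (λ k → + 1 * + (k C suc q) - + (suc k C suc q)) ≡⟨ Binomial.transform-cong n simplify ⟩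
  Binomial.transform n (λ k → - + (k C q))                           ≡⟨ Binomial.transform-neg n _ ⟩
  - B n q                                                            ∎
  where
  cancel : ∀ u v → + 1 * v - (u ⊕ v) ≡ - u
  cancel = solve-∀
  simplify : ∀ k → + 1 * + (k C suc q) - + (suc k C suc q) ≡ - + (k C q)
  simplify k = trans (cong (λ x → + 1 * + (k C suc q) - x) (pascal k q)) (cancel (+ (k C q)) (+ (k C suc q)))

B-below : ∀ n q → q < n → B n q ≡ + 0
B-below (suc n) zero    _         = B-suc-zero n
B-below (suc n) (suc q) (s≤s q<n) = trans (B-suc-suc n q) (cong -_ (B-below n q q<n))

B-diagonal : ∀ n → B n n ≡ sign n
B-diagonal zero    = refl
B-diagonal (suc n) = trans (B-suc-suc n n) (cong -_ (B-diagonal n))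

double-sum≡ : ∀ n p →
  sumTo n (λ k → sumTo k (λ j → + (n C k) * + stirling2 k j * + stirling1 (suc j) p * sign j))
  ≡ sumTo n (λ k → + (n C k) * T k p)
double-sum≡ n p = sum-cong n (λ k →
  trans (sum-cong k (λ j → regroup (+ (n C k)) (+ stirling2 k j) (+ stirling1 (suc j) p) (sign j)))
        (sum-scale k (+ (n C k)) _))
  where
  regroup : ∀ c x u s → c * x * u * s ≡ c * (x * (s * u))
  regroup = solve-∀

double-sum≡B : ∀ n q →
  sumTo n (λ k → sumTo k (λ j → + (n C k) * + stirling2 k j * + stirling1 (suc j) (suc q) * sign j))
  ≡ B n q
double-sum≡B n q = trans (double-sum≡ n (suc q)) (sum-cong n (λ k → cong (+ (n C k) *_) (T-closed k q)))

double-sum-zero : ∀ n →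
  sumTo n (λ k → sumTo k (λ j → + (n C k) * + stirling2 k j * + stirling1 (suc j) 0 * sign j))
  ≡ + 0
double-sum-zero n = trans (double-sum≡ n 0)
  (sum-zero n _ (λ k → trans (cong (+ (n C k) *_) (T-zero k)) (*-zeroʳ (+ (n C k)))))

mainTheorem4 : (n p : ℕ) → p ≤ suc n →
    ((p < suc n → sumTo n (λ k → sumTo k (λ j → + (n C k) * + stirling2 k j * + stirling1 (suc j) p * sign j)) ≡ + 0)
    × (p ≡ suc n → sumTo n (λ k → sumTo k (λ j → + (n C k) * + stirling2 k j * + stirling1 (suc j) p * sign j)) ≡ sign n))
mainTheorem4 n zero    _ = (λ _ → double-sum-zero n) , (λ ())
mainTheorem4 n (suc q) _ =
    (λ { (s≤s q<n) → trans (double-sum≡B n q) (B-below n q q<n) })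
  , (λ { refl → trans (double-sum≡B n n) (B-diagonal n) })
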